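{- Let $G$ be a broken wheel consisting of the path $v_2v_3\dots v_k$ ($k>3$) and a vertex $v_1$ adjacent to all of $v_2,\dots,v_k$, with principal path $\overrightarrow{v_kv_1v_2}$, and let $e=v_1v_p$ with $p\notin\{2,k\}$. Then $P(G-\overrightarrow{v_kv_1v_2}-e)$ contains a non-vanishing monomial $\eta\,v_1^0v_2^0v_k^0\prod_{i=3}^{k-1}v_i^2$.
   Context: For a graph $G$, vertices are also variables and $P(G)=\prod_{xy\in E(G),\,x<y}(x-y)$ for a fixed arbitrary orientation; a monomial is non-vanishing if its coefficient is nonzero. $G-\overrightarrow{v_kv_1v_2}-e$ is $G$ with edges $v_kv_1$, $v_1v_2$ and $e$ deleted (vertices kept). -}

module Defs where

open import Data.Bool using (Bool; true; false; if_then_else_; _∧_; _∨_)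
open import Data.Nat as ℕ using (ℕ; zero; suc; _∸_; _≡ᵇ_; _≤ᵇ_)
open import Data.Integer as ℤ using (ℤ; +_; -[1+_])
open import Data.Fin using (Fin; toℕ)
open import Data.List using (List; []; _∷_; _++_; map; concatMap; foldr; applyUpTo; filterᵇ)
open import Data.Bool.ListAction using (any)
open import Data.Vec using (Vec; tabulate; zipWith; replicate)
open import Data.Vec.Properties using (≡-dec)
open import Data.Product using (_×_; _,_)
open import Relation.Nullary using (yes; no)

-- Vertices of a graph on k vertices are labelled 1,…,k (vertex vᵢ has label i).
-- A graph is given by its list of edges (unordered pairs, stored as pairs).
Edge : Set
Edge = ℕ × ℕ

Graph : Set
Graph = List Edge

fromTo : ℕ → ℕ → List ℕ
fromTo a b = applyUpTo (a ℕ.+_) (suc b ∸ a)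

brokenWheel : ℕ → Graph
brokenWheel k = map (λ i → (i , suc i)) (fromTo 2 (k ∸ 1))
             ++ map (λ j → (1 , j)) (fromTo 2 k)

sameEdge : Edge → Edge → Bool
sameEdge (a , b) (c , d) = ((a ≡ᵇ c) ∧ (b ≡ᵇ d)) ∨ ((a ≡ᵇ d) ∧ (b ≡ᵇ c))

deleteEdges : Graph → List Edge → Graph
deleteEdges G ds = filterᵇ (λ f → Data.Bool.not (any (sameEdge f) ds)) G

-- Multivariate polynomials over ℤ in variables x₁,…,x_k, represented as
-- formal sums of terms (coefficient , exponent vector); exponent of xᵢ
-- is stored at position i-1.

Mono : ℕ → Set
Mono k = Vec ℕ k

Poly : ℕ → Set
Poly k = List (ℤ × Mono k)

var : ∀ {k} → ℕ → Mono k
var i = tabulate (λ j → if suc (toℕ j) ≡ᵇ i then 1 else 0)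

oneP : ∀ {k} → Poly k
oneP = (+ 1 , replicate _ 0) ∷ []

_*P_ : ∀ {k} → Poly k → Poly k → Poly k
p *P q = concatMap (λ { (a , m) → map (λ { (b , n) → (a ℤ.* b , zipWith ℕ._+_ m n) }) q }) p

coeff : ∀ {k} → Mono k → Poly k → ℤ
coeff m [] = + 0
coeff m ((a , n) ∷ p) with ≡-dec ℕ._≟_ m n
... | yes _ = a ℤ.+ coeff m p
... | no  _ = coeff m p

edgeFactor : ∀ {k} → Edge → Poly k
edgeFactor (a , b) = (+ 1 , var (a ℕ.⊓ b)) ∷ (-[1+ 0 ] , var (a ℕ.⊔ b)) ∷ []

graphPoly : ∀ k → Graph → Poly k
graphPoly k G = foldr (λ e acc → edgeFactor e *P acc) oneP G

targetMono : ∀ k → Mono k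
targetMono k = tabulate (λ j → if (3 ≤ᵇ suc (toℕ j)) ∧ (suc (toℕ j) ≤ᵇ k ∸ 1) then 2 else 0)

{-# OPTIONS --safe #-}
-- Expanding P = ∏ (x_a − x_b) factor by factor, a coefficient is a signed count of the ways of
-- picking one endpoint from every edge so that each vertex is picked as often as its exponent.
-- As v₁ has exponent 0, each remaining spoke v₁v_j must pick v_j, using up the single unit of
-- every v_j with j ∉ {2, p, k}; the path v₂ … v_k must then pick v_p twice, every other inner
-- vertex once and never v₂ or v_k, which forces every path edge to point towards v_p. So exactly
-- one expansion survives and the coefficient is ±1. Walking along the path, a wrong pick dies
-- either because it leaves a spoke with both endpoints exhausted or because it leaves a vertex
-- with a larger exponent than the edges still containing it.
module Submission where

open import Data.Bool using (Bool; true; false; not; if_then_else_; _∧_; _∨_; T)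
open import Data.Bool.Properties using (∨-zeroʳ; ∧-zeroʳ; T-≡; T-not-≡)
open import Data.Bool.ListAction using (any)
open import Data.Empty using (⊥-elim)
open import Data.Fin as Fin using (Fin; toℕ; fromℕ<)
open import Data.Fin.Properties using (toℕ-fromℕ<)
open import Data.Integer as ℤ using (ℤ; +_; 0ℤ; 1ℤ; -1ℤ)
import Data.Integer.Properties as ℤₚ
open import Data.List using (List; []; _∷_; _++_; map; applyUpTo)
open import Data.List.Properties using (map-++; ++-assoc; ++-identityʳ; filter-++; filter-all; filter-reject)
open import Data.List.Relation.Unary.All as All using (All; []; _∷_)
import Data.List.Relation.Unary.All.Properties as All
open import Data.List.Relation.Unary.Any as Any using (Any; here; there)
import Data.List.Relation.Unary.Any.Properties as Any
open import Data.Nat using (ℕ; zero; suc; pred; _+_; _∸_; _⊓_; _⊔_; _≤_; _<_; _≡ᵇ_; _<ᵇ_; _≤ᵇ_; _<?_; z≤n; s≤s)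
import Data.Nat.Properties as ℕₚ
open import Data.Nat.Solver using (module +-*-Solver)
open import Data.Product using (_×_; _,_; proj₁)
open import Data.Sum using (_⊎_; inj₁; inj₂)
open import Data.Vec using (Vec; tabulate; zipWith; replicate; lookup)
import Data.Vec as Vec
open import Data.Vec.Properties using (≡-dec; lookup∘tabulate; tabulate∘lookup; tabulate-cong; lookup-zipWith; lookup-replicate; ∷-injective)
open import Function.Base using (_∘_)
open import Function.Bundles using (Equivalence)
open import Relation.Binary.PropositionalEquality
open import Relation.Nullary using (Dec; yes; no)
open import Relation.Nullary.Reflects using (ofʸ; ofⁿ)
open import Relation.Nullary.Decidable using (T?)

open import Defs

≡ᵇ-refl : ∀ n → (n ≡ᵇ n) ≡ true
≡ᵇ-refl zero    = refl
≡ᵇ-refl (suc n) = ≡ᵇ-refl n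

≡ᵇ≡true⇒≡ : ∀ m n → (m ≡ᵇ n) ≡ true → m ≡ n
≡ᵇ≡true⇒≡ m n eq = ℕₚ.≡ᵇ⇒≡ m n (Equivalence.from T-≡ eq)

≢⇒≡ᵇ≡false : ∀ {m n} → m ≢ n → (m ≡ᵇ n) ≡ false
≢⇒≡ᵇ≡false {m} {n} m≢n with m ≡ᵇ n in eq
... | false = refl
... | true  = ⊥-elim (m≢n (≡ᵇ≡true⇒≡ m n eq))

multiplicity : ℕ → List ℕ → ℕ
multiplicity v []       = 0
multiplicity v (j ∷ js) = if v ≡ᵇ j then suc (multiplicity v js) else multiplicity v js

multiplicity-++ : ∀ v xs ys → multiplicity v (xs ++ ys) ≡ multiplicity v xs + multiplicity v ys
multiplicity-++ v []       ys = refl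
multiplicity-++ v (x ∷ xs) ys with v ≡ᵇ x
... | true  = cong suc (multiplicity-++ v xs ys)
... | false = multiplicity-++ v xs ys

multiplicity-head : ∀ v vs → multiplicity v (v ∷ vs) ≡ suc (multiplicity v vs)
multiplicity-head v vs rewrite ≡ᵇ-refl v = refl

multiplicity-∷-≢ : ∀ {v j} vs → v ≢ j → multiplicity v (j ∷ vs) ≡ multiplicity v vs
multiplicity-∷-≢ vs v≢j rewrite ≢⇒≡ᵇ≡false v≢j = refl

multiplicity-≤-∷ : ∀ v x xs → multiplicity v xs ≤ multiplicity v (x ∷ xs)
multiplicity-≤-∷ v x xs with v ≡ᵇ x
... | true  = ℕₚ.n≤1+n _
... | false = ℕₚ.≤-refl

multiplicity-≡0 : ∀ {v xs} → All (λ x → v ≢ x) xs → multiplicity v xs ≡ 0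
multiplicity-≡0 []           = refl
multiplicity-≡0 (v≢x ∷ v≢xs) rewrite ≢⇒≡ᵇ≡false v≢x = multiplicity-≡0 v≢xs

multiplicity>0⇒∈ : ∀ v xs → 0 < multiplicity v xs → Any (v ≡_) xs
multiplicity>0⇒∈ v (x ∷ xs) pos with v ≡ᵇ x in eq
... | true  = here (≡ᵇ≡true⇒≡ v x eq)
... | false = there (multiplicity>0⇒∈ v xs pos)

-- Monomials are given by exponent functions (f l is the exponent of x_l); lower v f divides by
-- x_v, truncating at 0 (divCoeff discards the quotient when f v = 0).
lower : ℕ → (ℕ → ℕ) → ℕ → ℕ
lower v f l = if l ≡ᵇ v then pred (f l) else f l

lower-self : ∀ v f → lower v f v ≡ pred (f v)
lower-self v f rewrite ≡ᵇ-refl v = refl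

lower-≢ : ∀ {v l} f → l ≢ v → lower v f l ≡ f l
lower-≢ f l≢v rewrite ≢⇒≡ᵇ≡false l≢v = refl

lower-≡0 : ∀ {v l} f → f l ≡ 0 → lower v f l ≡ 0
lower-≡0 {v} {l} f fl≡0 with l ≡ᵇ v
... | true  = cong pred fl≡0
... | false = fl≡0

lower-multiplicity : ∀ {f v vs} → (∀ l → f l ≡ multiplicity l (v ∷ vs)) → ∀ l → lower v f l ≡ multiplicity l vs
lower-multiplicity {f} {v} hf l with l ≡ᵇ v | hf l
... | true  | fl = cong pred fl
... | false | fl = fl

multiplicity<⇒multiplicity<lower : ∀ {l v} f vs → multiplicity l (v ∷ vs) < f l → multiplicity l vs < lower v f l
multiplicity<⇒multiplicity<lower {l} {v} f vs m<fl with l ≡ᵇ v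
... | true  = ℕₚ.<⇒≤pred m<fl
... | false = m<fl

monomial : ∀ {k} → (ℕ → ℕ) → Mono k
monomial f = tabulate (λ j → f (suc (toℕ j)))

lookup-monomial : ∀ {k v} f (v<k : v < k) → lookup (monomial {k} f) (fromℕ< v<k) ≡ f (suc v)
lookup-monomial f v<k = trans (lookup∘tabulate _ (fromℕ< v<k)) (cong (f ∘ suc) (toℕ-fromℕ< v<k))

monomial-zeros : ∀ {k} f → (∀ l → f l ≡ 0) → monomial {k} f ≡ replicate k 0
monomial-zeros {k} f f≡0 = begin
  monomial f                         ≡⟨ tabulate-cong (λ j → trans (f≡0 _) (sym (lookup-replicate j 0))) ⟩
  tabulate (lookup (replicate k 0))  ≡⟨ tabulate∘lookup (replicate k 0) ⟩
  replicate k 0                      ∎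
  where open ≡-Reasoning

monomial-≢zeros : ∀ {k v} f → 1 ≤ v → v ≤ k → 0 < f v → monomial {k} f ≢ replicate k 0
monomial-≢zeros {k} {suc v} f _ v<k fv>0 eq = ℕₚ.<⇒≢ fv>0 (sym (begin
  f (suc v)                         ≡⟨ lookup-monomial f v<k ⟨
  lookup (monomial f) (fromℕ< v<k)  ≡⟨ cong (λ m → lookup m (fromℕ< v<k)) eq ⟩
  lookup (replicate k 0) (fromℕ< v<k) ≡⟨ lookup-replicate (fromℕ< v<k) 0 ⟩
  0                                 ∎))
  where open ≡-Reasoning

zipWith-+-cancelˡ : ∀ {k} (u m m′ : Vec ℕ k) → zipWith _+_ u m ≡ zipWith _+_ u m′ → m ≡ m′
zipWith-+-cancelˡ Vec.[]       Vec.[]       Vec.[]         _  = refl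
zipWith-+-cancelˡ (x Vec.∷ u) (y Vec.∷ m) (y′ Vec.∷ m′) eq with ∷-injective eq
... | x+y≡x+y′ , rest = cong₂ Vec._∷_ (ℕₚ.+-cancelˡ-≡ x y y′ x+y≡x+y′) (zipWith-+-cancelˡ u m m′ rest)

zipWith-+-tabulate : ∀ {k} (g h : Fin k → ℕ) → zipWith _+_ (tabulate g) (tabulate h) ≡ tabulate (λ j → g j + h j)
zipWith-+-tabulate {zero}  g h = refl
zipWith-+-tabulate {suc k} g h = cong (g Fin.zero + h Fin.zero Vec.∷_) (zipWith-+-tabulate (g ∘ Fin.suc) (h ∘ Fin.suc))

var-+-lower : ∀ {k v t} f → f v ≡ suc t → zipWith _+_ (var {k} v) (monomial (lower v f)) ≡ monomial f
var-+-lower {v = v} f fv = trans (zipWith-+-tabulate _ _) (tabulate-cong (λ j → pointwise (suc (toℕ j))))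
  where
  pointwise : ∀ l → (if l ≡ᵇ v then 1 else 0) + lower v f l ≡ f l
  pointwise l with l ≡ᵇ v in eq
  ... | false = refl
  ... | true with refl ← ≡ᵇ≡true⇒≡ l v eq rewrite fv = refl

var-+-≢monomial : ∀ {k v} f → 1 ≤ v → v ≤ k → f v ≡ 0 → ∀ m → zipWith _+_ (var {k} v) m ≢ monomial f
var-+-≢monomial {v = suc v} f _ v<k fv≡0 m eq = ℕₚ.1+n≢0 (begin
  suc (lookup m j)                                     ≡⟨ cong (λ b → (if b then 1 else 0) + lookup m j) (≡ᵇ-refl v) ⟨
  (if v ≡ᵇ v then 1 else 0) + lookup m j               ≡⟨ cong (_+ lookup m j) (lookup-monomial (λ l → if l ≡ᵇ suc v then 1 else 0) v<k) ⟨
  lookup (var (suc v)) j + lookup m j                  ≡⟨ lookup-zipWith _+_ j (var (suc v)) m ⟨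
  lookup (zipWith _+_ (var (suc v)) m) j               ≡⟨ cong (λ x → lookup x j) eq ⟩
  lookup (monomial f) j                                ≡⟨ lookup-monomial f v<k ⟩
  f (suc v)                                            ≡⟨ fv≡0 ⟩
  0                                                    ∎)
  where
  open ≡-Reasoning
  j = fromℕ< v<k

coeff-++ : ∀ {k} (m : Mono k) p q → coeff m (p ++ q) ≡ coeff m p ℤ.+ coeff m q
coeff-++ m []            q = sym (ℤₚ.+-identityˡ _)
coeff-++ m ((a , n) ∷ p) q with ≡-dec ℕₚ._≟_ m n
... | yes _ = trans (cong (λ x → a ℤ.+ x) (coeff-++ m p q)) (sym (ℤₚ.+-assoc a _ _))
... | no  _ = coeff-++ m p q

coeff-oneP-zeros : ∀ {k} → coeff (replicate k 0) oneP ≡ 1ℤ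
coeff-oneP-zeros {k} with ≡-dec ℕₚ._≟_ (replicate k 0) (replicate k 0)
... | yes _   = refl
... | no  ≢0s = ⊥-elim (≢0s refl)

coeff-oneP-≢zeros : ∀ {k} {m : Mono k} → m ≢ replicate k 0 → coeff m oneP ≡ 0ℤ
coeff-oneP-≢zeros {k} {m} m≢0s with ≡-dec ℕₚ._≟_ m (replicate k 0)
... | yes m≡0s = ⊥-elim (m≢0s m≡0s)
... | no  _    = refl

module _ {k} {φ : ℤ × Mono k → ℤ × Mono k} {c : ℤ} {u : Mono k}
         (φ-shifts : ∀ b n → φ (b , n) ≡ (c ℤ.* b , zipWith _+_ u n)) where

  coeff-map-shift : ∀ {m m′} → zipWith _+_ u m′ ≡ m → ∀ q → coeff m (map φ q) ≡ c ℤ.* coeff m′ q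
  coeff-map-shift u+m′≡m [] = sym (ℤₚ.*-zeroʳ c)
  coeff-map-shift {m} {m′} u+m′≡m ((b , n) ∷ q) rewrite φ-shifts b n
    with ≡-dec ℕₚ._≟_ m (zipWith _+_ u n) | ≡-dec ℕₚ._≟_ m′ n
  ... | yes _    | yes _    = trans (cong (λ x → c ℤ.* b ℤ.+ x) (coeff-map-shift u+m′≡m q)) (sym (ℤₚ.*-distribˡ-+ c b _))
  ... | yes m≡un | no  m′≢n = ⊥-elim (m′≢n (zipWith-+-cancelˡ u m′ n (trans u+m′≡m m≡un)))
  ... | no  m≢un | yes m′≡n = ⊥-elim (m≢un (trans (sym u+m′≡m) (cong (zipWith _+_ u) m′≡n)))
  ... | no  _    | no  _    = coeff-map-shift u+m′≡m q

  coeff-map-shift-∉ : ∀ {m} → (∀ m′ → zipWith _+_ u m′ ≢ m) → ∀ q → coeff m (map φ q) ≡ 0ℤ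
  coeff-map-shift-∉ m∉ [] = refl
  coeff-map-shift-∉ {m} m∉ ((b , n) ∷ q) rewrite φ-shifts b n with ≡-dec ℕₚ._≟_ m (zipWith _+_ u n)
  ... | yes m≡un = ⊥-elim (m∉ n (sym m≡un))
  ... | no  _    = coeff-map-shift-∉ m∉ q

whenPositive : ℕ → ℤ → ℤ
whenPositive zero    _ = 0ℤ
whenPositive (suc _) c = c

whenPositive-0ℤ : ∀ n → whenPositive n 0ℤ ≡ 0ℤ
whenPositive-0ℤ zero    = refl
whenPositive-0ℤ (suc _) = refl

coeff-map-var : ∀ {k v} {φ : ℤ × Mono k → ℤ × Mono k} (c : ℤ) →
  (∀ b n → φ (b , n) ≡ (c ℤ.* b , zipWith _+_ (var v) n)) → 1 ≤ v → v ≤ k → ∀ f q →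
  coeff (monomial f) (map φ q) ≡ c ℤ.* whenPositive (f v) (coeff (monomial (lower v f)) q)
coeff-map-var {v = v} c φ-shifts 1≤v v≤k f q with f v in fv
... | zero  = trans (coeff-map-shift-∉ {c = c} φ-shifts (var-+-≢monomial f 1≤v v≤k fv) q) (sym (ℤₚ.*-zeroʳ c))
... | suc _ = coeff-map-shift {c = c} φ-shifts (var-+-lower f fv) q

coeff-edgeFactor-*P : ∀ {k a b} → 1 ≤ a → a ≤ b → b ≤ k → ∀ f (q : Poly k) →
  coeff (monomial f) (edgeFactor (a , b) *P q) ≡
    whenPositive (f a) (coeff (monomial (lower a f)) q) ℤ.- whenPositive (f b) (coeff (monomial (lower b f)) q)
coeff-edgeFactor-*P {k} {a} {b} 1≤a a≤b b≤k f q =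
  subst₂ (λ x y → coeff (monomial f) (edgeFactor (a , b) *P q) ≡ D x ℤ.- D y)
         (ℕₚ.m≤n⇒m⊓n≡m a≤b) (ℕₚ.m≤n⇒m⊔n≡n a≤b) unoriented
  where
  D : ℕ → ℤ
  D v = whenPositive (f v) (coeff (monomial (lower v f)) q)
  unoriented : coeff (monomial f) (edgeFactor (a , b) *P q) ≡ D (a ⊓ b) ℤ.- D (a ⊔ b)
  unoriented = trans (coeff-++ (monomial f) (map _ q) (map _ q ++ [])) (cong₂ ℤ._+_
    (trans (coeff-map-var 1ℤ (λ _ _ → refl) (ℕₚ.⊓-glb 1≤a (ℕₚ.≤-trans 1≤a a≤b)) (ℕₚ.≤-trans (ℕₚ.m⊓n≤n a b) b≤k) f q)
           (ℤₚ.*-identityˡ _))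
    (trans (coeff-++ (monomial f) (map _ q) [])
    (trans (ℤₚ.+-identityʳ _)
    (trans (coeff-map-var -1ℤ (λ _ _ → refl) (ℕₚ.≤-trans 1≤a (ℕₚ.m≤m⊔n a b)) (ℕₚ.⊔-lub (ℕₚ.≤-trans a≤b b≤k) b≤k) f q)
           (ℤₚ.-1*i≡-i _)))))

OrderedEdge : ℕ → Edge → Set
OrderedEdge k (a , b) = 1 ≤ a × a ≤ b × b ≤ k

divCoeff : ∀ k → ℕ → (ℕ → ℕ) → Graph → ℤ
divCoeff k v f G = whenPositive (f v) (coeff (monomial (lower v f)) (graphPoly k G))

coeff-graphPoly-∷ : ∀ {k a b} → OrderedEdge k (a , b) → ∀ f G →
  coeff (monomial f) (graphPoly k ((a , b) ∷ G)) ≡ divCoeff k a f G ℤ.- divCoeff k b f G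
coeff-graphPoly-∷ (1≤a , a≤b , b≤k) f G = coeff-edgeFactor-*P 1≤a a≤b b≤k f (graphPoly _ G)

divCoeff-zero : ∀ {k} v f G → f v ≡ 0 → divCoeff k v f G ≡ 0ℤ
divCoeff-zero v f G fv≡0 rewrite fv≡0 = refl

divCoeff-suc : ∀ {k t} v f G → f v ≡ suc t → divCoeff k v f G ≡ coeff (monomial (lower v f)) (graphPoly k G)
divCoeff-suc v f G fv≡1+t rewrite fv≡1+t = refl

divCoeff-vanishes : ∀ {k} v f G → coeff (monomial (lower v f)) (graphPoly k G) ≡ 0ℤ → divCoeff k v f G ≡ 0ℤ
divCoeff-vanishes v f G c≡0 = trans (cong (whenPositive (f v)) c≡0) (whenPositive-0ℤ (f v))

BothZero : (ℕ → ℕ) → Edge → Set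
BothZero f (a , b) = f a ≡ 0 × f b ≡ 0

coeff-graphPoly-bothZero : ∀ {k G} f → All (OrderedEdge k) G → Any (BothZero f) G → coeff (monomial f) (graphPoly k G) ≡ 0ℤ
coeff-graphPoly-bothZero {G = (a , b) ∷ G} f (ab ∷ _) (here (fa≡0 , fb≡0)) =
  trans (coeff-graphPoly-∷ ab f G) (cong₂ ℤ._-_ (divCoeff-zero a f G fa≡0) (divCoeff-zero b f G fb≡0))
coeff-graphPoly-bothZero {G = (a , b) ∷ G} f (ab ∷ within) (there zero∈G) =
  trans (coeff-graphPoly-∷ ab f G) (cong₂ ℤ._-_ (vanishes a) (vanishes b))
  where
  lowered : ∀ v e → BothZero f e → BothZero (lower v f) e
  lowered v (x , y) (fx≡0 , fy≡0) = lower-≡0 f fx≡0 , lower-≡0 f fy≡0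
  vanishes : ∀ v → divCoeff _ v f G ≡ 0ℤ
  vanishes v = divCoeff-vanishes v f G (coeff-graphPoly-bothZero (lower v f) within (Any.map (lowered v _) zero∈G))

endpoints : Graph → List ℕ
endpoints []            = []
endpoints ((a , b) ∷ G) = a ∷ b ∷ endpoints G

degree : ℕ → Graph → ℕ
degree v G = multiplicity v (endpoints G)

coeff-graphPoly-degree< : ∀ {k G v} f → All (OrderedEdge k) G → 1 ≤ v → v ≤ k → degree v G < f v →
  coeff (monomial f) (graphPoly k G) ≡ 0ℤ
coeff-graphPoly-degree< {G = []} f [] 1≤v v≤k 0<fv = coeff-oneP-≢zeros (monomial-≢zeros f 1≤v v≤k 0<fv)
coeff-graphPoly-degree< {G = (a , b) ∷ G} {v} f (ab ∷ within) 1≤v v≤k d<fv =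
  trans (coeff-graphPoly-∷ ab f G) (cong₂ ℤ._-_ (vanishes a d<lower-a) (vanishes b d<lower-b))
  where
  vanishes : ∀ x → degree v G < lower x f v → divCoeff _ x f G ≡ 0ℤ
  vanishes x d<fv′ = divCoeff-vanishes x f G (coeff-graphPoly-degree< (lower x f) within 1≤v v≤k d<fv′)
  d<lower-a : degree v G < lower a f v
  d<lower-a = ℕₚ.≤-<-trans (multiplicity-≤-∷ v b (endpoints G)) (multiplicity<⇒multiplicity<lower f (b ∷ endpoints G) d<fv)
  d<lower-b : degree v G < lower b f v
  d<lower-b = multiplicity<⇒multiplicity<lower f (endpoints G) (ℕₚ.≤-<-trans (multiplicity-≤-∷ v a (b ∷ endpoints G)) d<fv)

endpoints-++ : ∀ G H → endpoints (G ++ H) ≡ endpoints G ++ endpoints H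
endpoints-++ []            H = refl
endpoints-++ ((a , b) ∷ G) H = cong (λ es → a ∷ b ∷ es) (endpoints-++ G H)

degree-++ : ∀ v G H → degree v (G ++ H) ≡ degree v G + degree v H
degree-++ v G H = trans (cong (multiplicity v) (endpoints-++ G H)) (multiplicity-++ v (endpoints G) (endpoints H))

IsUnit : ℤ → Set
IsUnit c = c ≡ 1ℤ ⊎ c ≡ -1ℤ

isUnit⇒≢0 : ∀ {c} → IsUnit c → c ≢ 0ℤ
isUnit⇒≢0 (inj₁ refl) ()
isUnit⇒≢0 (inj₂ refl) ()

isUnit-minus-0ℤ : ∀ {c} → IsUnit c → IsUnit (c ℤ.- 0ℤ)
isUnit-minus-0ℤ (inj₁ refl) = inj₁ refl
isUnit-minus-0ℤ (inj₂ refl) = inj₂ refl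

isUnit-0ℤ-minus : ∀ {c} → IsUnit c → IsUnit (0ℤ ℤ.- c)
isUnit-0ℤ-minus (inj₁ refl) = inj₂ refl
isUnit-0ℤ-minus (inj₂ refl) = inj₁ refl

module _ {k a b} (ab : OrderedEdge k (a , b)) (f : ℕ → ℕ) (G : Graph) where

  isUnit-∷-viaLow : ∀ {t} → f a ≡ suc t → IsUnit (coeff (monomial (lower a f)) (graphPoly k G)) →
    divCoeff k b f G ≡ 0ℤ → IsUnit (coeff (monomial f) (graphPoly k ((a , b) ∷ G)))
  isUnit-∷-viaLow fa≡1+t unit b-vanishes = subst IsUnit
    (sym (trans (coeff-graphPoly-∷ ab f G) (cong₂ ℤ._-_ (divCoeff-suc a f G fa≡1+t) b-vanishes)))
    (isUnit-minus-0ℤ unit)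

  isUnit-∷-viaHigh : ∀ {t} → f b ≡ suc t → IsUnit (coeff (monomial (lower b f)) (graphPoly k G)) →
    divCoeff k a f G ≡ 0ℤ → IsUnit (coeff (monomial f) (graphPoly k ((a , b) ∷ G)))
  isUnit-∷-viaHigh fb≡1+t unit a-vanishes = subst IsUnit
    (sym (trans (coeff-graphPoly-∷ ab f G) (cong₂ ℤ._-_ a-vanishes (divCoeff-suc b f G fb≡1+t))))
    (isUnit-0ℤ-minus unit)

star : List ℕ → Graph
star = map (1 ,_)

star-within : ∀ {k js} → All (λ j → 2 ≤ j × j ≤ k) js → All (OrderedEdge k) (star js)
star-within = All.map⁺ ∘ All.map (λ (2≤j , j≤k) → ℕₚ.≤-refl , ℕₚ.<⇒≤ 2≤j , j≤k)

degree-star : ∀ {v} js → v ≢ 1 → degree v (star js) ≡ multiplicity v js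
degree-star []       v≢1 = refl
degree-star {v} (j ∷ js) v≢1 rewrite ≢⇒≡ᵇ≡false v≢1 with v ≡ᵇ j
... | true  = cong suc (degree-star js v≢1)
... | false = degree-star js v≢1

coeff-star-isUnit : ∀ {k js} f → All (λ j → 2 ≤ j × j ≤ k) js → (∀ l → f l ≡ multiplicity l js) →
  IsUnit (coeff (monomial f) (graphPoly k (star js)))
coeff-star-isUnit {k} {[]} f [] f≡0 =
  inj₁ (trans (cong (λ m → coeff m oneP) (monomial-zeros {k} f f≡0)) (coeff-oneP-zeros {k}))
coeff-star-isUnit {k} {j ∷ js} f within@((2≤j , j≤k) ∷ within′) f≡mult =
  isUnit-∷-viaHigh (ℕₚ.≤-refl , ℕₚ.<⇒≤ 2≤j , j≤k) f (star js)
    (trans (f≡mult j) (multiplicity-head j js))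
    (coeff-star-isUnit (lower j f) within′ (lower-multiplicity {vs = js} f≡mult))
    (divCoeff-zero 1 f (star js) (trans (f≡mult 1) (multiplicity-≡0 (All.map (ℕₚ.<⇒≢ ∘ proj₁) within))))

consecutive : ℕ → ℕ → List ℕ
consecutive s zero    = []
consecutive s (suc n) = s ∷ consecutive (suc s) n

consecutive-++ : ∀ s m n → consecutive s (m + n) ≡ consecutive s m ++ consecutive (s + m) n
consecutive-++ s zero    n = cong (λ x → consecutive x n) (sym (ℕₚ.+-identityʳ s))
consecutive-++ s (suc m) n = cong (s ∷_) (trans (consecutive-++ (suc s) m n)
  (cong (λ x → consecutive (suc s) m ++ consecutive x n) (sym (ℕₚ.+-suc s m))))

consecutive-within : ∀ s n → All (λ j → s ≤ j × j < s + n) (consecutive s n)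
consecutive-within s zero    = []
consecutive-within s (suc n) = (ℕₚ.≤-refl , ℕₚ.m<m+n s (s≤s z≤n))
  ∷ All.map (λ {j} (s<j , j<1+s+n) → ℕₚ.<⇒≤ s<j , subst (j <_) (sym (ℕₚ.+-suc s n)) j<1+s+n) (consecutive-within (suc s) n)

applyUpTo-consecutive : ∀ s n {f : ℕ → ℕ} → (∀ i → f i ≡ s + i) → applyUpTo f n ≡ consecutive s n
applyUpTo-consecutive s zero    f≡s+ = refl
applyUpTo-consecutive s (suc n) f≡s+ = cong₂ _∷_ (trans (f≡s+ 0) (ℕₚ.+-identityʳ s))
  (applyUpTo-consecutive (suc s) n (λ i → trans (f≡s+ (suc i)) (ℕₚ.+-suc s i)))

multiplicity-consecutive-∉ : ∀ {l} s n → l < s ⊎ s + n ≤ l → multiplicity l (consecutive s n) ≡ 0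
multiplicity-consecutive-∉ s n (inj₁ l<s) =
  multiplicity-≡0 (All.map (λ (s≤j , _) → ℕₚ.<⇒≢ (ℕₚ.<-≤-trans l<s s≤j)) (consecutive-within s n))
multiplicity-consecutive-∉ s n (inj₂ s+n≤l) =
  multiplicity-≡0 (All.map (λ (_ , j<s+n) → ℕₚ.>⇒≢ (ℕₚ.<-≤-trans j<s+n s+n≤l)) (consecutive-within s n))

multiplicity-consecutive-∈ : ∀ {l} s n → s ≤ l → l < s + n → multiplicity l (consecutive s n) ≡ 1
multiplicity-consecutive-∈ {l} s zero s≤l l<s+0 = ⊥-elim (ℕₚ.<⇒≱ l<s+0 (subst (_≤ l) (sym (ℕₚ.+-identityʳ s)) s≤l))
multiplicity-consecutive-∈ {l} s (suc n) s≤l l<s+1+n with l ℕₚ.≟ s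
... | yes refl = trans (multiplicity-head l (consecutive (suc l) n)) (cong suc (multiplicity-consecutive-∉ (suc l) n (inj₁ (ℕₚ.n<1+n l))))
... | no  l≢s  = trans (multiplicity-∷-≢ (consecutive (suc s) n) l≢s)
  (multiplicity-consecutive-∈ (suc s) n (ℕₚ.≤∧≢⇒< s≤l (l≢s ∘ sym)) (subst (l <_) (ℕₚ.+-suc s n) l<s+1+n))

multiplicity-consecutive : ∀ l s n →
  multiplicity l (consecutive s (suc n)) ≡ (if (s ≤ᵇ l) ∧ (l ≤ᵇ s + n) then 1 else 0)
multiplicity-consecutive l s n with s ≤ᵇ l | ℕₚ.≤ᵇ-reflects-≤ s l | l ≤ᵇ s + n | ℕₚ.≤ᵇ-reflects-≤ l (s + n)
... | true  | ofʸ s≤l | true  | ofʸ l≤s+n =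
  multiplicity-consecutive-∈ s (suc n) s≤l (subst (l <_) (sym (ℕₚ.+-suc s n)) (s≤s l≤s+n))
... | true  | ofʸ _   | false | ofⁿ l≰s+n =
  multiplicity-consecutive-∉ s (suc n) (inj₂ (subst (_≤ l) (sym (ℕₚ.+-suc s n)) (ℕₚ.≰⇒> l≰s+n)))
... | false | ofⁿ s≰l | _     | _         = multiplicity-consecutive-∉ s (suc n) (inj₁ (ℕₚ.≰⇒> s≰l))

multiplicity-consecutive-≤1 : ∀ l s n → multiplicity l (consecutive s n) ≤ 1
multiplicity-consecutive-≤1 l s zero = z≤n
multiplicity-consecutive-≤1 l s (suc n) rewrite multiplicity-consecutive l s n with (s ≤ᵇ l) ∧ (l ≤ᵇ s + n)
... | true  = ℕₚ.≤-refl
... | false = z≤n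

endTowards : ℕ → ℕ → ℕ
endTowards q i = if i <ᵇ q then suc i else i

endTowards-< : ∀ {q i} → i < q → endTowards q i ≡ suc i
endTowards-< {q} {i} i<q with i <ᵇ q | ℕₚ.<ᵇ-reflects-< i q
... | true  | _        = refl
... | false | ofⁿ i≮q = ⊥-elim (i≮q i<q)

endTowards-≥ : ∀ {q i} → q ≤ i → endTowards q i ≡ i
endTowards-≥ {q} {i} q≤i with i <ᵇ q | ℕₚ.<ᵇ-reflects-< i q
... | true  | ofʸ i<q = ⊥-elim (ℕₚ.<⇒≱ i<q q≤i)
... | false | _       = refl

≤-endTowards : ∀ q i → i ≤ endTowards q i
≤-endTowards q i with i <ᵇ q
... | true  = ℕₚ.n≤1+n i
... | false = ℕₚ.≤-refl

map-endTowards-below : ∀ q s n → s + n ≤ q → map (endTowards q) (consecutive s n) ≡ consecutive (suc s) n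
map-endTowards-below q s zero    _      = refl
map-endTowards-below q s (suc n) s+n≤q = cong₂ _∷_
  (endTowards-< (ℕₚ.<-≤-trans (ℕₚ.m<m+n s (s≤s z≤n)) s+n≤q))
  (map-endTowards-below q (suc s) n (subst (_≤ q) (ℕₚ.+-suc s n) s+n≤q))

map-endTowards-above : ∀ q s n → q ≤ s → map (endTowards q) (consecutive s n) ≡ consecutive s n
map-endTowards-above q s zero    _   = refl
map-endTowards-above q s (suc n) q≤s = cong₂ _∷_ (endTowards-≥ q≤s) (map-endTowards-above q (suc s) n (ℕₚ.m≤n⇒m≤1+n q≤s))

path : ℕ → ℕ → Graph
path s n = map (λ i → (i , suc i)) (consecutive s n)

path-within : ∀ {k} s n → 1 ≤ s → s + n ≤ k → All (OrderedEdge k) (path s n)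
path-within {k} s zero    _   _     = []
path-within {k} s (suc n) 1≤s s+n≤k = (1≤s , ℕₚ.n≤1+n s , ℕₚ.≤-trans (s≤s (ℕₚ.m≤m+n s n)) 1+s+n≤k)
  ∷ path-within (suc s) n (s≤s z≤n) 1+s+n≤k
  where 1+s+n≤k = subst (_≤ k) (ℕₚ.+-suc s n) s+n≤k

degree-path : ∀ {v} s n → v < s → degree v (path s n) ≡ 0
degree-path s zero    _   = refl
degree-path s (suc n) v<s
  rewrite ≢⇒≡ᵇ≡false (ℕₚ.<⇒≢ v<s) | ≢⇒≡ᵇ≡false (ℕₚ.<⇒≢ (ℕₚ.m<n⇒m<1+n v<s)) = degree-path (suc s) n (ℕₚ.m<n⇒m<1+n v<s)

module _ {k q : ℕ} {js : List ℕ}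
         (js-within : All (λ j → 2 ≤ j × j ≤ k) js) (js-simple : ∀ l → l < q → multiplicity l js ≤ 1) where

  -- The variables picked by the surviving expansion of P(path s n ++ star js): each path
  -- edge (i, i+1) picks its end towards q and each spoke (1, j) picks j.
  picked : ℕ → ℕ → List ℕ
  picked s n = map (endTowards q) (consecutive s n) ++ js

  picked-≥2 : ∀ s n → 2 ≤ s → All (2 ≤_) (picked s n)
  picked-≥2 s n 2≤s = All.++⁺
    (All.map⁺ (All.map (λ {i} (s≤i , _) → ℕₚ.≤-trans 2≤s (ℕₚ.≤-trans s≤i (≤-endTowards q i))) (consecutive-within s n)))
    (All.map proj₁ js-within)

  multiplicity-picked-below : ∀ s n → multiplicity s (picked (suc s) n) ≡ multiplicity s js
  multiplicity-picked-below s n = trans (multiplicity-++ s (map (endTowards q) (consecutive (suc s) n)) js)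
    (cong (_+ multiplicity s js) (multiplicity-≡0 (All.map⁺
      (All.map (λ {i} (s<i , _) → ℕₚ.<⇒≢ (ℕₚ.<-≤-trans s<i (≤-endTowards q i))) (consecutive-within (suc s) n)))))

  rest-within : ∀ s n → suc s + n ≤ k → All (OrderedEdge k) (path (suc s) n ++ star js)
  rest-within s n 1+s+n≤k = All.++⁺ (path-within (suc s) n (s≤s z≤n) 1+s+n≤k) (star-within js-within)

  -- Picking x_s while s < q exhausts x_s, so the spoke (1, s), present if x_s was needed at all,
  -- is left with both endpoints at exponent 0.
  divCoeff-low-vanishes : ∀ s n f → 2 ≤ s → suc s + n ≤ k → s < q →
    (∀ l → f l ≡ multiplicity l (suc s ∷ picked (suc s) n)) → divCoeff k s f (path (suc s) n ++ star js) ≡ 0ℤ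
  divCoeff-low-vanishes s n f 2≤s 1+s+n≤k s<q f≡mult = by-multiplicity (multiplicity s js) refl (js-simple s s<q)
    where
    fs≡ : f s ≡ multiplicity s js
    fs≡ = trans (f≡mult s) (trans (multiplicity-∷-≢ (picked (suc s) n) (ℕₚ.<⇒≢ (ℕₚ.n<1+n s))) (multiplicity-picked-below s n))
    f1≡0 : f 1 ≡ 0
    f1≡0 = trans (f≡mult 1) (multiplicity-≡0 (All.map ℕₚ.<⇒≢ (ℕₚ.≤-trans 2≤s (ℕₚ.n≤1+n s) ∷ picked-≥2 (suc s) n (ℕₚ.m≤n⇒m≤1+n 2≤s))))
    dead : ∀ {j} → s ≡ j → multiplicity s js ≡ 1 → BothZero (lower s f) (1 , j)
    dead refl ms≡1 = trans (lower-≢ f (ℕₚ.<⇒≢ 2≤s)) f1≡0 , trans (lower-self s f) (cong pred (trans fs≡ ms≡1))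
    by-multiplicity : ∀ m → multiplicity s js ≡ m → m ≤ 1 → divCoeff k s f (path (suc s) n ++ star js) ≡ 0ℤ
    by-multiplicity zero          ms≡0 _ = divCoeff-zero s f (path (suc s) n ++ star js) (trans fs≡ ms≡0)
    by-multiplicity (suc zero)    ms≡1 _ = divCoeff-vanishes s f (path (suc s) n ++ star js) (coeff-graphPoly-bothZero (lower s f) (rest-within s n 1+s+n≤k)
      (Any.++⁺ʳ (path (suc s) n) (Any.map⁺ (Any.map (λ s≡j → dead s≡j ms≡1) (multiplicity>0⇒∈ s js (subst (0 <_) (sym ms≡1) (s≤s z≤n)))))))
    by-multiplicity (suc (suc _)) _ (s≤s ())

  -- Picking x_{s+1} while q ≤ s leaves x_s with more exponent than the spokes at s can supply.
  divCoeff-high-vanishes : ∀ s n f → 2 ≤ s → suc s + n ≤ k →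
    (∀ l → f l ≡ multiplicity l (s ∷ picked (suc s) n)) → divCoeff k (suc s) f (path (suc s) n ++ star js) ≡ 0ℤ
  divCoeff-high-vanishes s n f 2≤s 1+s+n≤k f≡mult = divCoeff-vanishes (suc s) f (path (suc s) n ++ star js)
    (coeff-graphPoly-degree< (lower (suc s) f) (rest-within s n 1+s+n≤k)
      (ℕₚ.≤-trans (s≤s z≤n) 2≤s) (ℕₚ.<⇒≤ (ℕₚ.≤-trans (ℕₚ.m≤m+n (suc s) n) 1+s+n≤k)) degree<)
    where
    open ℕₚ.≤-Reasoning
    degree< : degree s (path (suc s) n ++ star js) < lower (suc s) f s
    degree< = begin-strict
      degree s (path (suc s) n ++ star js)         ≡⟨ degree-++ s (path (suc s) n) (star js) ⟩
      degree s (path (suc s) n) + degree s (star js) ≡⟨ cong₂ _+_ (degree-path (suc s) n (ℕₚ.n<1+n s)) (degree-star js (ℕₚ.>⇒≢ 2≤s)) ⟩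
      multiplicity s js                            <⟨ ℕₚ.n<1+n _ ⟩
      suc (multiplicity s js)                      ≡⟨ cong suc (multiplicity-picked-below s n) ⟨
      suc (multiplicity s (picked (suc s) n))      ≡⟨ multiplicity-head s (picked (suc s) n) ⟨
      multiplicity s (s ∷ picked (suc s) n)        ≡⟨ f≡mult s ⟨
      f s                                          ≡⟨ lower-≢ f (ℕₚ.<⇒≢ (ℕₚ.n<1+n s)) ⟨
      lower (suc s) f s                            ∎

  coeff-pathStar-isUnit : ∀ s n f → 2 ≤ s → s + n ≤ k → (∀ l → f l ≡ multiplicity l (picked s n)) →
    IsUnit (coeff (monomial f) (graphPoly k (path s n ++ star js)))
  coeff-pathStar-isUnit s zero    f _   _     f≡mult = coeff-star-isUnit f js-within f≡mult
  coeff-pathStar-isUnit s (suc n) f 2≤s s+n≤k f≡mult = by-orientation (s <? q)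
    where
    1+s+n≤k : suc s + n ≤ k
    1+s+n≤k = subst (_≤ k) (ℕₚ.+-suc s n) s+n≤k
    edge : OrderedEdge k (s , suc s)
    edge = ℕₚ.≤-trans (s≤s z≤n) 2≤s , ℕₚ.n≤1+n s , ℕₚ.≤-trans (ℕₚ.m≤m+n (suc s) n) 1+s+n≤k
    f≡picked : ∀ {x} → endTowards q s ≡ x → ∀ l → f l ≡ multiplicity l (x ∷ picked (suc s) n)
    f≡picked end≡x l = trans (f≡mult l) (cong (λ x → multiplicity l (x ∷ picked (suc s) n)) end≡x)
    rest-isUnit : ∀ f′ → (∀ l → f′ l ≡ multiplicity l (picked (suc s) n)) →
      IsUnit (coeff (monomial f′) (graphPoly k (path (suc s) n ++ star js)))
    rest-isUnit f′ = coeff-pathStar-isUnit (suc s) n f′ (ℕₚ.m≤n⇒m≤1+n 2≤s) 1+s+n≤k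
    by-orientation : Dec (s < q) → IsUnit (coeff (monomial f) (graphPoly k (path s (suc n) ++ star js)))
    by-orientation (yes s<q) = isUnit-∷-viaHigh edge f (path (suc s) n ++ star js)
      (trans (f≡high (suc s)) (multiplicity-head (suc s) (picked (suc s) n)))
      (rest-isUnit (lower (suc s) f) (lower-multiplicity {vs = picked (suc s) n} f≡high))
      (divCoeff-low-vanishes s n f 2≤s 1+s+n≤k s<q f≡high)
      where f≡high = f≡picked (endTowards-< s<q)
    by-orientation (no s≮q) = isUnit-∷-viaLow edge f (path (suc s) n ++ star js)
      (trans (f≡low s) (multiplicity-head s (picked (suc s) n)))
      (rest-isUnit (lower s f) (lower-multiplicity {vs = picked (suc s) n} f≡low))
      (divCoeff-high-vanishes s n f 2≤s 1+s+n≤k f≡low)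
      where f≡low = f≡picked (endTowards-≥ (ℕₚ.≮⇒≥ s≮q))

any-≡false : ∀ {A : Set} (p : A → Bool) {xs} → All (λ x → p x ≡ false) xs → any p xs ≡ false
any-≡false p []           = refl
any-≡false p (px≡f ∷ pxs) rewrite px≡f = any-≡false p pxs

sameEdge-≡false : ∀ a b c d → a ≢ c ⊎ b ≢ d → a ≢ d ⊎ b ≢ c → sameEdge (a , b) (c , d) ≡ false
sameEdge-≡false a b c d (inj₁ a≢c) (inj₁ a≢d) rewrite ≢⇒≡ᵇ≡false a≢c | ≢⇒≡ᵇ≡false a≢d = refl
sameEdge-≡false a b c d (inj₁ a≢c) (inj₂ b≢c) rewrite ≢⇒≡ᵇ≡false a≢c | ≢⇒≡ᵇ≡false b≢c = ∧-zeroʳ (a ≡ᵇ d)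
sameEdge-≡false a b c d (inj₂ b≢d) (inj₁ a≢d) rewrite ≢⇒≡ᵇ≡false b≢d | ≢⇒≡ᵇ≡false a≢d = cong (_∨ false) (∧-zeroʳ (a ≡ᵇ c))
sameEdge-≡false a b c d (inj₂ b≢d) (inj₂ b≢c) rewrite ≢⇒≡ᵇ≡false b≢d | ≢⇒≡ᵇ≡false b≢c =
  cong₂ _∨_ (∧-zeroʳ (a ≡ᵇ c)) (∧-zeroʳ (a ≡ᵇ d))

sameEdge-refl : ∀ a b → T (sameEdge (a , b) (a , b))
sameEdge-refl a b rewrite ≡ᵇ-refl a | ≡ᵇ-refl b = _

sameEdge-swap : ∀ a b → T (sameEdge (a , b) (b , a))
sameEdge-swap a b rewrite ≡ᵇ-refl a | ≡ᵇ-refl b = subst T (sym (∨-zeroʳ _)) _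

deleteEdges-++ : ∀ G H ds → deleteEdges (G ++ H) ds ≡ deleteEdges G ds ++ deleteEdges H ds
deleteEdges-++ G H ds = filter-++ (T? ∘ λ e → not (any (sameEdge e) ds)) G H

deleteEdges-keeps : ∀ {G} ds → All (λ e → All (λ d → sameEdge e d ≡ false) ds) G → deleteEdges G ds ≡ G
deleteEdges-keeps ds unmatched = filter-all (T? ∘ λ e → not (any (sameEdge e) ds))
  (All.map (λ {e} e-unmatched → Equivalence.from T-not-≡ (any-≡false (sameEdge e) e-unmatched)) unmatched)

deleteEdges-drops : ∀ {e} G ds → Any (λ d → T (sameEdge e d)) ds → deleteEdges (e ∷ G) ds ≡ deleteEdges G ds
deleteEdges-drops {e} G ds matched = filter-reject (T? ∘ λ e → not (any (sameEdge e) ds))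
  (λ kept → subst T (Equivalence.to T-not-≡ kept) (Any.any⁺ (sameEdge e) matched))

-- Writing p = 3 + a and k = p + 1 + b builds 3 ≤ p < k into the shape of the numbers.
module _ (a b : ℕ) where
  private
    p k : ℕ
    p = 3 + a
    k = 4 + a + b
    removed : List Edge
    removed = (k , 1) ∷ (1 , 2) ∷ (1 , p) ∷ []
    leaves : List ℕ
    leaves = consecutive 3 a ++ consecutive (4 + a) b
    target : ℕ → ℕ
    target l = if (3 ≤ᵇ l) ∧ (l ≤ᵇ k ∸ 1) then 2 else 0
    p<k : p < k
    p<k = s≤s (ℕₚ.m≤m+n p b)

  interior-split : consecutive 3 (suc (a + b)) ≡ consecutive 3 a ++ consecutive p (suc b)
  interior-split = trans (cong (consecutive 3) (sym (ℕₚ.+-suc a b))) (consecutive-++ 3 a (suc b))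

  starEdge-unmatched : ∀ {j} → j ≢ 2 → j ≢ p → j ≢ k → All (λ d → sameEdge (1 , j) d ≡ false) removed
  starEdge-unmatched {j} j≢2 j≢p j≢k =
    sameEdge-≡false 1 j k 1 (inj₁ (λ ())) (inj₂ j≢k) ∷ sameEdge-≡false 1 j 1 2 (inj₂ j≢2) (inj₁ (λ ())) ∷
    sameEdge-≡false 1 j 1 p (inj₂ j≢p) (inj₁ (λ ())) ∷ []

  pathEdge-unmatched : ∀ {i} → 2 ≤ i → i < k → All (λ d → sameEdge (i , suc i) d ≡ false) removed
  pathEdge-unmatched {i} 2≤i i<k =
    sameEdge-≡false i (suc i) k 1 (inj₁ (ℕₚ.<⇒≢ i<k)) (inj₁ i≢1) ∷ sameEdge-≡false i (suc i) 1 2 (inj₁ i≢1) (inj₂ 1+i≢1) ∷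
    sameEdge-≡false i (suc i) 1 p (inj₁ i≢1) (inj₂ 1+i≢1) ∷ []
    where
    i≢1 = ℕₚ.>⇒≢ 2≤i
    1+i≢1 = ℕₚ.>⇒≢ (s≤s (ℕₚ.<⇒≤ 2≤i))

  star-deletion : deleteEdges (star (consecutive 2 (3 + (a + b)))) removed ≡ star leaves
  star-deletion = begin
    deleteEdges (star (2 ∷ consecutive 3 (suc (suc (a + b))))) removed
      ≡⟨ deleteEdges-drops {1 , 2} (star (consecutive 3 (suc (suc (a + b))))) removed (there (here _)) ⟩
    deleteEdges (star (consecutive 3 (suc (suc (a + b))))) removed
      ≡⟨ cong (λ vs → deleteEdges (star vs) removed) vertices ⟩
    deleteEdges (star (A ++ p ∷ (B ++ k ∷ []))) removed
      ≡⟨ cong (λ G → deleteEdges G removed) (map-++ (1 ,_) A (p ∷ (B ++ k ∷ []))) ⟩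
    deleteEdges (star A ++ (1 , p) ∷ star (B ++ k ∷ [])) removed
      ≡⟨ deleteEdges-++ (star A) ((1 , p) ∷ star (B ++ k ∷ [])) removed ⟩
    deleteEdges (star A) removed ++ deleteEdges ((1 , p) ∷ star (B ++ k ∷ [])) removed
      ≡⟨ cong₂ _++_ (deleteEdges-keeps removed A-unmatched)
                    (deleteEdges-drops {1 , p} (star (B ++ k ∷ [])) removed (there (there (here (sameEdge-refl 1 p))))) ⟩
    star A ++ deleteEdges (star (B ++ k ∷ [])) removed
      ≡⟨ cong (λ G → star A ++ deleteEdges G removed) (map-++ (1 ,_) B (k ∷ [])) ⟩
    star A ++ deleteEdges (star B ++ (1 , k) ∷ []) removed
      ≡⟨ cong (star A ++_) (deleteEdges-++ (star B) ((1 , k) ∷ []) removed) ⟩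
    star A ++ (deleteEdges (star B) removed ++ deleteEdges ((1 , k) ∷ []) removed)
      ≡⟨ cong₂ (λ G H → star A ++ (G ++ H)) (deleteEdges-keeps removed B-unmatched)
                                            (deleteEdges-drops {1 , k} [] removed (here (sameEdge-swap 1 k))) ⟩
    star A ++ (star B ++ [])
      ≡⟨ cong (star A ++_) (++-identityʳ (star B)) ⟩
    star A ++ star B
      ≡⟨ map-++ (1 ,_) A B ⟨
    star leaves ∎
    where
    open ≡-Reasoning
    A B : List ℕ
    A = consecutive 3 a
    B = consecutive (4 + a) b
    vertices : consecutive 3 (suc (suc (a + b))) ≡ A ++ p ∷ (B ++ k ∷ [])
    vertices = begin
      consecutive 3 (suc (suc (a + b)))      ≡⟨ cong (consecutive 3) (ℕₚ.+-comm 1 (suc (a + b))) ⟩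
      consecutive 3 (suc (a + b) + 1)        ≡⟨ consecutive-++ 3 (suc (a + b)) 1 ⟩
      consecutive 3 (suc (a + b)) ++ k ∷ []  ≡⟨ cong (_++ k ∷ []) interior-split ⟩
      (A ++ p ∷ B) ++ k ∷ []                 ≡⟨ ++-assoc A (p ∷ B) (k ∷ []) ⟩
      A ++ p ∷ (B ++ k ∷ [])                 ∎
    A-unmatched : All (λ e → All (λ d → sameEdge e d ≡ false) removed) (star A)
    A-unmatched = All.map⁺ (All.map (λ (3≤j , j<p) →
      starEdge-unmatched (ℕₚ.>⇒≢ 3≤j) (ℕₚ.<⇒≢ j<p) (ℕₚ.<⇒≢ (ℕₚ.<-trans j<p p<k))) (consecutive-within 3 a))
    B-unmatched : All (λ e → All (λ d → sameEdge e d ≡ false) removed) (star B)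
    B-unmatched = All.map⁺ (All.map (λ (p<j , j<k) →
      starEdge-unmatched (ℕₚ.>⇒≢ (ℕₚ.≤-trans (ℕₚ.m≤m+n 3 (suc a)) p<j)) (ℕₚ.>⇒≢ p<j) (ℕₚ.<⇒≢ j<k)) (consecutive-within (4 + a) b))

  deleteEdges-brokenWheel : deleteEdges (brokenWheel k) removed ≡ path 2 (2 + (a + b)) ++ star leaves
  deleteEdges-brokenWheel = begin
    deleteEdges (brokenWheel k) removed
      ≡⟨ deleteEdges-++ (map (λ i → (i , suc i)) (fromTo 2 (k ∸ 1))) (star (fromTo 2 k)) removed ⟩
    deleteEdges (map (λ i → (i , suc i)) (fromTo 2 (k ∸ 1))) removed ++ deleteEdges (star (fromTo 2 k)) removed
      ≡⟨ cong₂ (λ xs ys → deleteEdges (map (λ i → (i , suc i)) xs) removed ++ deleteEdges (star ys) removed)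
               (applyUpTo-consecutive 2 (2 + (a + b)) (λ _ → refl)) (applyUpTo-consecutive 2 (3 + (a + b)) (λ _ → refl)) ⟩
    deleteEdges (path 2 (2 + (a + b))) removed ++ deleteEdges (star (consecutive 2 (3 + (a + b)))) removed
      ≡⟨ cong₂ _++_ (deleteEdges-keeps removed path-unmatched) star-deletion ⟩
    path 2 (2 + (a + b)) ++ star leaves ∎
    where
    open ≡-Reasoning
    path-unmatched : All (λ e → All (λ d → sameEdge e d ≡ false) removed) (path 2 (2 + (a + b)))
    path-unmatched = All.map⁺ (All.map (λ (2≤i , i<k) → pathEdge-unmatched 2≤i i<k) (consecutive-within 2 (2 + (a + b))))

  leaves-within : All (λ j → 2 ≤ j × j ≤ k) leaves
  leaves-within = All.++⁺
    (All.map (λ (3≤j , j<p) → ℕₚ.<⇒≤ 3≤j , ℕₚ.<⇒≤ (ℕₚ.<-trans j<p p<k)) (consecutive-within 3 a))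
    (All.map (λ (p<j , j<k) → ℕₚ.≤-trans (ℕₚ.m≤m+n 2 (2 + a)) p<j , ℕₚ.<⇒≤ j<k) (consecutive-within (4 + a) b))

  leaves-simple : ∀ l → l < p → multiplicity l leaves ≤ 1
  leaves-simple l l<p = subst (_≤ 1) (sym multiplicity-leaves) (multiplicity-consecutive-≤1 l 3 a)
    where
    multiplicity-leaves : multiplicity l leaves ≡ multiplicity l (consecutive 3 a)
    multiplicity-leaves = trans (multiplicity-++ l (consecutive 3 a) (consecutive (4 + a) b))
      (trans (cong (λ x → multiplicity l (consecutive 3 a) + x) (multiplicity-consecutive-∉ (4 + a) b (inj₁ (ℕₚ.m<n⇒m<1+n l<p))))
             (ℕₚ.+-identityʳ _))

  picked-path : map (endTowards p) (consecutive 2 (2 + (a + b))) ≡ consecutive 3 (suc a) ++ consecutive p (suc b)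
  picked-path = begin
    map (endTowards p) (2 ∷ consecutive 3 (suc (a + b)))
      ≡⟨ cong (map (endTowards p) ∘ (2 ∷_)) interior-split ⟩
    map (endTowards p) (consecutive 2 (suc a) ++ consecutive p (suc b))
      ≡⟨ map-++ (endTowards p) (consecutive 2 (suc a)) (consecutive p (suc b)) ⟩
    map (endTowards p) (consecutive 2 (suc a)) ++ map (endTowards p) (consecutive p (suc b))
      ≡⟨ cong₂ _++_ (map-endTowards-below p 2 (suc a) ℕₚ.≤-refl) (map-endTowards-above p p (suc b) ℕₚ.≤-refl) ⟩
    consecutive 3 (suc a) ++ consecutive p (suc b) ∎
    where open ≡-Reasoning

  target-multiplicity : ∀ l → target l ≡ multiplicity l (map (endTowards p) (consecutive 2 (2 + (a + b))) ++ leaves)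
  target-multiplicity l = begin
    target l
      ≡⟨ twice (multiplicity-consecutive l 3 (a + b)) ⟩
    m (consecutive 3 (suc (a + b))) + m (consecutive 3 (suc (a + b)))
      ≡⟨ cong₂ _+_ (trans (cong m interior-split) (multiplicity-++ l A P))
                   (trans (cong m (consecutive-++ 3 (suc a) b)) (multiplicity-++ l A′ B)) ⟩
    (m A + m P) + (m A′ + m B)
      ≡⟨ swap (m A) (m P) (m A′) (m B) ⟩
    (m A′ + m P) + (m A + m B)
      ≡⟨ cong₂ _+_ (multiplicity-++ l A′ P) (multiplicity-++ l A B) ⟨
    m (A′ ++ P) + m leaves
      ≡⟨ multiplicity-++ l (A′ ++ P) leaves ⟨
    m ((A′ ++ P) ++ leaves)
      ≡⟨ cong (λ xs → m (xs ++ leaves)) picked-path ⟨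
    m (map (endTowards p) (consecutive 2 (2 + (a + b))) ++ leaves) ∎
    where
    open ≡-Reasoning
    open +-*-Solver
    m = multiplicity l
    A A′ P B : List ℕ
    A  = consecutive 3 a
    A′ = consecutive 3 (suc a)
    P  = consecutive p (suc b)
    B  = consecutive (4 + a) b
    twice : ∀ {x c} → x ≡ (if c then 1 else 0) → (if c then 2 else 0) ≡ x + x
    twice {c = true}  refl = refl
    twice {c = false} refl = refl
    swap : ∀ w x y z → (w + x) + (y + z) ≡ (y + x) + (w + z)
    swap = solve 4 (λ w x y z → (w :+ x) :+ (y :+ z) := (y :+ x) :+ (w :+ z)) refl

  coeff-target-isUnit : IsUnit (coeff (targetMono k) (graphPoly k (deleteEdges (brokenWheel k) removed)))
  coeff-target-isUnit = subst (λ G → IsUnit (coeff (targetMono k) (graphPoly k G))) (sym deleteEdges-brokenWheel)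
    (coeff-pathStar-isUnit {q = p} leaves-within leaves-simple 2 (2 + (a + b)) target ℕₚ.≤-refl ℕₚ.≤-refl target-multiplicity)

lemma5p14 : (k p : ℕ) → 3 < k → 2 ≤ p → p ≤ k → p ≢ 2 → p ≢ k →
    coeff (targetMono k)
      (graphPoly k (deleteEdges (brokenWheel k) ((k , 1) ∷ (1 , 2) ∷ (1 , p) ∷ [])))
      ≢ + 0
-- The hypothesis 3 < k is implied by 3 ≤ p < k.
lemma5p14 k p _ 2≤p p≤k p≢2 p≢k with ℕₚ.m≤n⇒∃[o]m+o≡n (ℕₚ.≤∧≢⇒< 2≤p (p≢2 ∘ sym))
... | a , refl with ℕₚ.m≤n⇒∃[o]m+o≡n (ℕₚ.≤∧≢⇒< p≤k p≢k)
... | b , refl = isUnit⇒≢0 (coeff-target-isUnit a b)
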